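{- Let $n\ge 1$ and $1\le k\le n$ be integers, let $U=\{u_1,\dots,u_n\}$ and $V=\{v_1,\dots,v_n\}$ be the two parts of the complete bipartite graph $K_{n,n}$. For subsets $A\subseteq U$, $B\subseteq V$ with $|A|=|B|=k$, let $x=x(A,B)\in\mathbb{R}^{n^2}$ be the vector with $x_{i,j}=1$ if $u_i\in A$ and $v_j\in B$, and $x_{i,j}=0$ otherwise; write $U(x)=A$, $V(x)=B$. Let $X_{n,k}$ be the set of all such vectors and let $WBCBS(n,k)=\operatorname{conv}(X_{n,k})$. Then two distinct vertices $x,y\in X_{n,k}$ of the polytope $WBCBS(n,k)$ are adjacent (i.e. the segment $[x,y]$ is an edge of the polytope) if and only if either (i) $U(x)\neq U(y)$ and $V(x)\neq V(y)$, or (ii) $U(x)=U(y)$ and $|V(x)\setminus V(y)|=1$, or (iii) $V(x)=V(y)$ and $|U(x)\setminus U(y)|=1$.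
   Context: Every point of $X_{n,k}$ is a vertex of $\operatorname{conv}(X_{n,k})$ (it is a $0/1$ vector). Two vertices of a polytope are adjacent if they span a 1-dimensional face of it.
   Formalization: The ambient space is ℚ^(n²) rather than $\mathbb{R}^{n^2}$, so the points of $WBCBS(n,k)$, the convex weights and the linear functional exposing the edge $[x,y]$ are all rational. -}

module Defs where

open import Data.Nat using (ℕ)
open import Agda.Builtin.Nat as ℕ using ()
open import Data.Fin using (Fin; zero; suc)
open import Data.Bool using (Bool; true; false; _∧_; if_then_else_)
open import Data.Vec using (lookup)
open import Data.Fin.Subset using (Subset; ∣_∣)
open import Data.Rational using (ℚ; 0ℚ; 1ℚ; _+_; _*_; _-_; _≤_)
open import Data.List using (List; []; _∷_)
open import Data.List.Relation.Unary.All using (All)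
open import Data.Product using (Σ; ∃; _×_; _,_)
open import Relation.Binary.PropositionalEquality using (_≡_)

Vec² : ℕ → Set
Vec² n = Fin n → Fin n → ℚ

sumFin : ∀ {n} → (Fin n → ℚ) → ℚ
sumFin {ℕ.zero}  f = 0ℚ
sumFin {ℕ.suc n} f = f zero + sumFin (λ i → f (suc i))

x⟨_,_⟩ : ∀ {n} → Subset n → Subset n → Vec² n
x⟨ A , B ⟩ i j = if lookup A i ∧ lookup B j then 1ℚ else 0ℚ

-- (A , B) indexes a point of X_{n,k}
InX : ∀ {n} (k : ℕ) → Subset n → Subset n → Set
InX k A B = ∣ A ∣ ≡ k × ∣ B ∣ ≡ k

dot : ∀ {n} → Vec² n → Vec² n → ℚ
dot c p = sumFin (λ i → sumFin (λ j → c i j * p i j))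

Weighted : ℕ → Set
Weighted n = List (ℚ × Subset n × Subset n)

weightSum : ∀ {n} → Weighted n → ℚ
weightSum [] = 0ℚ
weightSum ((t , _ , _) ∷ L) = t + weightSum L

combo : ∀ {n} → Weighted n → Vec² n
combo [] i j = 0ℚ
combo ((t , A , B) ∷ L) i j = t * x⟨ A , B ⟩ i j + combo L i j

InConv : ∀ {n} (k : ℕ) → Vec² n → Set
InConv {n} k p = Σ (Weighted n) λ L →
    All (λ { (t , A , B) → (0ℚ ≤ t) × InX k A B }) L
  × weightSum L ≡ 1ℚ
  × (∀ i j → p i j ≡ combo L i j)

InSegment : ∀ {n} → Vec² n → Vec² n → Vec² n → Set
InSegment x y p = ∃ λ t → (0ℚ ≤ t) × (t ≤ 1ℚ)
  × (∀ i j → p i j ≡ t * x i j + (1ℚ - t) * y i j)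

-- x and y are adjacent vertices of conv(X_{n,k}): the segment [x , y] is a face,
-- i.e. there is a linear functional c whose maximisers in conv(X_{n,k})
-- are exactly the points of [x , y]
Adjacent : ∀ {n} (k : ℕ) → Vec² n → Vec² n → Set
Adjacent {n} k x y = Σ (Vec² n) λ c →
    (∀ p → InConv k p → dot c p ≤ dot c x)
  × dot c x ≡ dot c y
  × (∀ p → InConv k p → dot c p ≡ dot c x → InSegment x y p)

-- For "if", take the functional c = x + y. Cellwise, (x + y) z ≤ z + x y for 0/1 values, with
-- equality iff x y ≤ z ≤ x + y; as every vertex z = x(P,Q) has Σ z = k², the vertices maximising c
-- are exactly those whose rectangle P × Q lies between (A ∩ A′) × (B ∩ B′) and (A × B) ∪ (A′ × B′).
-- Comparing sizes, under (i)–(iii) such a rectangle is A × B or A′ × B′, and a convex combination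
-- of vertices maximises c only if it is supported on x and y, i.e. lies on [x, y].
-- For "only if", suppose U(x) = U(y) but |V(x) ∖ V(y)| ≥ 2 (the case V(x) = V(y) is symmetric).
-- Moving one column u of V(x) ∖ V(y) to V(y) and one column v of V(y) ∖ V(x) back gives vertices
-- z, z′ with x + y = z + z′, so z maximises every functional that is maximal on [x, y]. Yet z is
-- not on [x, y]: x and y agree on the columns u and u′ ∈ V(x) ∖ V(y), while z does not.

module Submission where

module BicliquePolytope where

  open import Defs
  open import Data.Nat as ℕ using (ℕ; zero; suc)
  import Data.Nat.Properties as ℕ
  open import Data.Bool using (Bool; true; false; _∧_; if_then_else_)
  open import Data.Bool.Properties using (∧-conicalˡ; ∧-conicalʳ; ∧-zeroʳ)
  import Data.Bool as Bool
  open import Data.Fin using (Fin; zero; suc; _≟_)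
  open import Data.Fin.Properties using (¬∀⟶∃¬)
  open import Data.Fin.Subset using (Subset; ∣_∣; _─_; _∈_; _∉_; _⊆_; ⁅_⁆; Nonempty; inside; outside)
  open import Data.Fin.Subset.Properties
    using (_∈?_; _⊆?_; nonempty?; Empty-unique; ∣⊥∣≡0; ⊆-antisym; p⊂q⇒∣p∣<∣q∣
          ; x∈⁅y⁆⇒x≡y; x∉⁅y⁆⇒x≢y; ∣⁅x⁆∣≡1; p─q⊆p; x∈p∧x∉q⇒x∈p─q)
  open import Data.Vec using ([]; _∷_; lookup; _[_]≔_; here; there)
  open import Data.Vec.Properties using (≡-dec; []=⇒lookup; lookup⇒[]=; lookup∘update; lookup∘update′)
  open import Data.Rational using (ℚ; 0ℚ; 1ℚ; _+_; _*_; _-_; _≤_; _<_; positive; nonNegative)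
  open import Data.Rational.Properties hiding (_≟_)
  open import Data.Rational.Solver using (module +-*-Solver)
  open import Data.List using ([]; _∷_)
  open import Data.List.Relation.Unary.All using (All; []; _∷_)
  open import Data.Product using (_×_; ∃; _,_; proj₁; proj₂; swap; uncurry)
  import Data.Sum as Sum
  open import Data.Sum using (_⊎_; inj₁; inj₂; [_,_]′)
  open import Function using (_∘_; id)
  open import Relation.Nullary using (¬_; yes; no; contradiction)
  open import Relation.Nullary.Decidable using (_→-dec_)
  open import Relation.Binary.Definitions using (tri<; tri≈; tri>)
  open import Relation.Binary.PropositionalEquality
    using (_≡_; _≢_; refl; sym; trans; cong; cong₂; subst; module ≡-Reasoning)

  open +-*-Solver using (solve; _:+_; _:*_; _:-_; _:=_; con)

  +-tight : ∀ {a b c d} → a ≤ b → c ≤ d → a + c ≡ b + d → a ≡ b × c ≡ d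
  +-tight a≤b c≤d eq =
    ≤-antisym a≤b (≮⇒≥ λ a<b → <⇒≢ (+-mono-<-≤ a<b c≤d) eq) ,
    ≤-antisym c≤d (≮⇒≥ λ c<d → <⇒≢ (+-mono-≤-< a≤b c<d) eq)

  *-cancelˡ-≡-pos : ∀ {t p q} → 0ℚ < t → t * p ≡ t * q → p ≡ q
  *-cancelˡ-≡-pos {t} {p} {q} 0<t eq with <-cmp p q
  ... | tri< p<q _ _ = contradiction eq (<⇒≢ (*-monoʳ-<-pos t {{positive 0<t}} p<q))
  ... | tri≈ _ p≡q _ = p≡q
  ... | tri> _ _ q<p = contradiction (sym eq) (<⇒≢ (*-monoʳ-<-pos t {{positive 0<t}} q<p))

  -- x⟨ A , B ⟩ i j is definitionally ⟦ lookup A i ∧ lookup B j ⟧.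
  ⟦_⟧ : Bool → ℚ
  ⟦ b ⟧ = if b then 1ℚ else 0ℚ

  ⟦∧⟧ : ∀ a b → ⟦ a ∧ b ⟧ ≡ ⟦ a ⟧ * ⟦ b ⟧
  ⟦∧⟧ false b = sym (*-zeroˡ ⟦ b ⟧)
  ⟦∧⟧ true  b = sym (*-identityˡ ⟦ b ⟧)

  fromℕ : ℕ → ℚ
  fromℕ zero    = 0ℚ
  fromℕ (suc m) = 1ℚ + fromℕ m

  sumFin-cong : ∀ {n} {f g : Fin n → ℚ} → (∀ i → f i ≡ g i) → sumFin f ≡ sumFin g
  sumFin-cong {zero}  f≗g = refl
  sumFin-cong {suc n} f≗g = cong₂ _+_ (f≗g zero) (sumFin-cong (f≗g ∘ suc))

  sumFin-+ : ∀ {n} (f g : Fin n → ℚ) → sumFin (λ i → f i + g i) ≡ sumFin f + sumFin g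
  sumFin-+ {zero}  f g = refl
  sumFin-+ {suc n} f g = trans (cong (f zero + g zero +_) (sumFin-+ (f ∘ suc) (g ∘ suc)))
    (solve 4 (λ a b c d → (a :+ b) :+ (c :+ d) := (a :+ c) :+ (b :+ d)) refl (f zero) (g zero) _ _)

  sumFin-*ˡ : ∀ {n} t (f : Fin n → ℚ) → sumFin (λ i → t * f i) ≡ t * sumFin f
  sumFin-*ˡ {zero}  t f = sym (*-zeroʳ t)
  sumFin-*ˡ {suc n} t f = trans (cong (t * f zero +_) (sumFin-*ˡ t (f ∘ suc))) (sym (*-distribˡ-+ t _ _))

  sumFin-*ʳ : ∀ {n} t (f : Fin n → ℚ) → sumFin (λ i → f i * t) ≡ sumFin f * t
  sumFin-*ʳ t f = trans (sumFin-cong (λ i → *-comm (f i) t)) (trans (sumFin-*ˡ t f) (*-comm t _))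

  sumFin-0 : ∀ {n} → sumFin {n} (λ _ → 0ℚ) ≡ 0ℚ
  sumFin-0 {zero}  = refl
  sumFin-0 {suc n} = trans (+-identityˡ _) (sumFin-0 {n})

  sumFin-mono : ∀ {n} {f g : Fin n → ℚ} → (∀ i → f i ≤ g i) → sumFin f ≤ sumFin g
  sumFin-mono {zero}  f≤g = ≤-refl
  sumFin-mono {suc n} f≤g = +-mono-≤ (f≤g zero) (sumFin-mono (f≤g ∘ suc))

  sumFin-tight : ∀ {n} {f g : Fin n → ℚ} → (∀ i → f i ≤ g i) → sumFin f ≡ sumFin g → ∀ i → f i ≡ g i
  sumFin-tight {suc n} f≤g eq zero    = proj₁ (+-tight (f≤g zero) (sumFin-mono (f≤g ∘ suc)) eq)
  sumFin-tight {suc n} f≤g eq (suc i) =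
    sumFin-tight (f≤g ∘ suc) (proj₂ (+-tight (f≤g zero) (sumFin-mono (f≤g ∘ suc)) eq)) i

  sumFin-indicator : ∀ {n} (S : Subset n) → sumFin (λ i → ⟦ lookup S i ⟧) ≡ fromℕ ∣ S ∣
  sumFin-indicator []            = refl
  sumFin-indicator (true  ∷ S) = cong (1ℚ +_) (sumFin-indicator S)
  sumFin-indicator (false ∷ S) = trans (+-identityˡ _) (sumFin-indicator S)

  infixl 6 _⊕_
  infixl 7 _⊗_ _·_
  infix 4 _≐_

  _⊕_ _⊗_ : ∀ {n} → Vec² n → Vec² n → Vec² n
  (p ⊕ q) i j = p i j + q i j
  (p ⊗ q) i j = p i j * q i j

  _·_ : ∀ {n} → ℚ → Vec² n → Vec² n
  (t · p) i j = t * p i j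

  _≐_ : ∀ {n} → Vec² n → Vec² n → Set
  p ≐ q = ∀ i j → p i j ≡ q i j

  Σ² : ∀ {n} → Vec² n → ℚ
  Σ² p = sumFin (λ i → sumFin (p i))

  Σ²-cong : ∀ {n} {p q : Vec² n} → p ≐ q → Σ² p ≡ Σ² q
  Σ²-cong p≐q = sumFin-cong (sumFin-cong ∘ p≐q)

  Σ²-⊕ : ∀ {n} (p q : Vec² n) → Σ² (p ⊕ q) ≡ Σ² p + Σ² q
  Σ²-⊕ p q = trans (sumFin-cong (λ i → sumFin-+ (p i) (q i))) (sumFin-+ (λ i → sumFin (p i)) (λ i → sumFin (q i)))

  Σ²-· : ∀ {n} t (p : Vec² n) → Σ² (t · p) ≡ t * Σ² p
  Σ²-· t p = trans (sumFin-cong (λ i → sumFin-*ˡ t (p i))) (sumFin-*ˡ t (λ i → sumFin (p i)))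

  Σ²-mono : ∀ {n} {p q : Vec² n} → (∀ i j → p i j ≤ q i j) → Σ² p ≤ Σ² q
  Σ²-mono p≤q = sumFin-mono (sumFin-mono ∘ p≤q)

  Σ²-tight : ∀ {n} {p q : Vec² n} → (∀ i j → p i j ≤ q i j) → Σ² p ≡ Σ² q → p ≐ q
  Σ²-tight p≤q eq i = sumFin-tight (p≤q i) (sumFin-tight (sumFin-mono ∘ p≤q) eq i)

  Σ²-vertex : ∀ {n} (P Q : Subset n) → Σ² x⟨ P , Q ⟩ ≡ fromℕ ∣ P ∣ * fromℕ ∣ Q ∣
  Σ²-vertex P Q = begin
      Σ² x⟨ P , Q ⟩
    ≡⟨ Σ²-cong (λ i j → ⟦∧⟧ (lookup P i) (lookup Q j)) ⟩
      sumFin (λ i → sumFin (λ j → ⟦ lookup P i ⟧ * ⟦ lookup Q j ⟧))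
    ≡⟨ sumFin-cong (λ i → sumFin-*ˡ ⟦ lookup P i ⟧ (λ j → ⟦ lookup Q j ⟧)) ⟩
      sumFin (λ i → ⟦ lookup P i ⟧ * sumFin (λ j → ⟦ lookup Q j ⟧))
    ≡⟨ sumFin-*ʳ (sumFin (λ j → ⟦ lookup Q j ⟧)) (λ i → ⟦ lookup P i ⟧) ⟩
      sumFin (λ i → ⟦ lookup P i ⟧) * sumFin (λ j → ⟦ lookup Q j ⟧)
    ≡⟨ cong₂ _*_ (sumFin-indicator P) (sumFin-indicator Q) ⟩
      fromℕ ∣ P ∣ * fromℕ ∣ Q ∣
    ∎
    where open ≡-Reasoning

  dot-cong : ∀ {n} (c : Vec² n) {p q : Vec² n} → p ≐ q → dot c p ≡ dot c q
  dot-cong c p≐q = Σ²-cong (λ i j → cong (c i j *_) (p≐q i j))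

  dot-⊕ : ∀ {n} (c p q : Vec² n) → dot c (p ⊕ q) ≡ dot c p + dot c q
  dot-⊕ c p q = trans (Σ²-cong (λ i j → *-distribˡ-+ (c i j) (p i j) (q i j))) (Σ²-⊕ (c ⊗ p) (c ⊗ q))

  dot-· : ∀ {n} (c : Vec² n) t p → dot c (t · p) ≡ t * dot c p
  dot-· c t p = trans (Σ²-cong λ i j → solve 3 (λ c t p → c :* (t :* p) := t :* (c :* p)) refl (c i j) t (p i j))
    (Σ²-· t (c ⊗ p))

  dot-combo-∷ : ∀ {n} (c : Vec² n) t P Q L → dot c (combo ((t , P , Q) ∷ L)) ≡ t * dot c x⟨ P , Q ⟩ + dot c (combo L)
  dot-combo-∷ c t P Q L = trans (dot-⊕ c (t · x⟨ P , Q ⟩) (combo L)) (cong (_+ dot c (combo L)) (dot-· c t x⟨ P , Q ⟩))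

  dot-combo-[] : ∀ {n} (c : Vec² n) → dot c (combo []) ≡ 0ℚ
  dot-combo-[] {n} c = trans (sumFin-cong λ i → trans (sumFin-cong λ j → *-zeroʳ (c i j)) (sumFin-0 {n})) (sumFin-0 {n})

  -- Faces of conv(X_{n,k})

  record InScaledSegment {n} (x y : Vec² n) (w : ℚ) (p : Vec² n) : Set where
    constructor scaled
    field
      s r   : ℚ
      0≤s   : 0ℚ ≤ s
      0≤r   : 0ℚ ≤ r
      s+r≡w : s + r ≡ w
      p≐    : p ≐ s · x ⊕ r · y

  0≤1 : 0ℚ ≤ 1ℚ
  0≤1 = nonNegative⁻¹ 1ℚ

  scaled-[] : ∀ {n} {x y : Vec² n} → InScaledSegment x y 0ℚ (combo [])
  scaled-[] {x = x} {y} = scaled 0ℚ 0ℚ ≤-refl ≤-refl refl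
    λ i j → solve 2 (λ a b → con 0ℚ := con 0ℚ :* a :+ con 0ℚ :* b) refl (x i j) (y i j)

  scaled-∷ : ∀ {n} {x y v p : Vec² n} {t w} → 0ℚ ≤ t → (t ≡ 0ℚ ⊎ v ≐ x ⊎ v ≐ y) →
             InScaledSegment x y w p → InScaledSegment x y (t + w) (t · v ⊕ p)
  scaled-∷ {v = v} {p} 0≤t (inj₁ refl) (scaled s r 0≤s 0≤r s+r≡w p≐) =
    scaled s r 0≤s 0≤r (trans s+r≡w (sym (+-identityˡ _)))
      λ i j → trans (trans (cong (_+ p i j) (*-zeroˡ (v i j))) (+-identityˡ _)) (p≐ i j)
  scaled-∷ {x = x} {y} {t = t} 0≤t (inj₂ (inj₁ v≐x)) (scaled s r 0≤s 0≤r s+r≡w p≐) =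
    scaled (t + s) r (+-mono-≤ 0≤t 0≤s) 0≤r (trans (+-assoc t s r) (cong (t +_) s+r≡w))
      λ i j → trans (cong₂ (λ a b → t * a + b) (v≐x i j) (p≐ i j))
        (solve 5 (λ t a s r b → t :* a :+ (s :* a :+ r :* b) := (t :+ s) :* a :+ r :* b) refl t (x i j) s r (y i j))
  scaled-∷ {x = x} {y} {t = t} 0≤t (inj₂ (inj₂ v≐y)) (scaled s r 0≤s 0≤r s+r≡w p≐) =
    scaled s (t + r) 0≤s (+-mono-≤ 0≤t 0≤r)
      (trans (solve 3 (λ s t r → s :+ (t :+ r) := t :+ (s :+ r)) refl s t r) (cong (t +_) s+r≡w))
      λ i j → trans (cong₂ (λ b q → t * b + q) (v≐y i j) (p≐ i j))
        (solve 5 (λ t b s a r → t :* b :+ (s :* a :+ r :* b) := s :* a :+ (t :+ r) :* b) refl t (y i j) s (x i j) r)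

  scaled-1⇒segment : ∀ {n} {x y p q : Vec² n} {w} → InScaledSegment x y w q → w ≡ 1ℚ → p ≐ q → InSegment x y p
  scaled-1⇒segment {x = x} {y} (scaled s r 0≤s 0≤r s+r≡w q≐) w≡1 p≐q =
    s , 0≤s , s≤1 , λ i j → trans (p≐q i j) (trans (q≐ i j) (cong (λ r → s * x i j + r * y i j) r≡1-s))
    where
    s+r≡1 : s + r ≡ 1ℚ
    s+r≡1 = trans s+r≡w w≡1
    s≤1 : s ≤ 1ℚ
    s≤1 = ≤-trans (≤-reflexive (sym (+-identityʳ s))) (≤-trans (+-monoʳ-≤ s 0≤r) (≤-reflexive s+r≡1))
    r≡1-s : r ≡ 1ℚ - s
    r≡1-s = trans (solve 2 (λ s r → r := (s :+ r) :- s) refl s r) (cong (_- s) s+r≡1)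

  module _ {n} {k : ℕ} (c x y : Vec² n)
           (bounded   : ∀ P Q → InX k P Q → dot c x⟨ P , Q ⟩ ≤ dot c x)
           (maximiser : ∀ P Q → InX k P Q → dot c x⟨ P , Q ⟩ ≡ dot c x → x⟨ P , Q ⟩ ≐ x ⊎ x⟨ P , Q ⟩ ≐ y)
    where

    private
      M : ℚ
      M = dot c x

      M*-+ : ∀ t w → t * M + M * w ≡ M * (t + w)
      M*-+ t w = solve 3 (λ t m w → t :* m :+ m :* w := m :* (t :+ w)) refl t M w

    module _ {R : ℚ × Subset n × Subset n → Set} (admissible : ∀ {t P Q} → R (t , P , Q) → 0ℚ ≤ t × InX k P Q) where

      combo-bounded : ∀ L → All R L → dot c (combo L) ≤ M * weightSum L
      combo-bounded [] [] = ≤-reflexive (trans (dot-combo-[] c) (sym (*-zeroʳ M)))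
      combo-bounded ((t , P , Q) ∷ L) (a ∷ as) = begin
          dot c (combo ((t , P , Q) ∷ L))
        ≡⟨ dot-combo-∷ c t P Q L ⟩
          t * dot c x⟨ P , Q ⟩ + dot c (combo L)
        ≤⟨ +-mono-≤ (*-monoˡ-≤-nonNeg t {{nonNegative 0≤t}} (bounded P Q PQ∈X)) (combo-bounded L as) ⟩
          t * M + M * weightSum L
        ≡⟨ M*-+ t (weightSum L) ⟩
          M * (t + weightSum L)
        ∎
        where
        open ≤-Reasoning
        0≤t = proj₁ (admissible a)
        PQ∈X = proj₂ (admissible a)

      combo-maximal : ∀ L → All R L → dot c (combo L) ≡ M * weightSum L → InScaledSegment x y (weightSum L) (combo L)
      combo-maximal [] [] _ = scaled-[]
      combo-maximal ((t , P , Q) ∷ L) (a ∷ as) eq = scaled-∷ 0≤t head (combo-maximal L as (proj₂ split))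
        where
        0≤t = proj₁ (admissible a)
        PQ∈X = proj₂ (admissible a)
        split : t * dot c x⟨ P , Q ⟩ ≡ t * M × dot c (combo L) ≡ M * weightSum L
        split = +-tight (*-monoˡ-≤-nonNeg t {{nonNegative 0≤t}} (bounded P Q PQ∈X)) (combo-bounded L as)
          (trans (sym (dot-combo-∷ c t P Q L)) (trans eq (sym (M*-+ t (weightSum L)))))
        head : t ≡ 0ℚ ⊎ x⟨ P , Q ⟩ ≐ x ⊎ x⟨ P , Q ⟩ ≐ y
        head with 0ℚ <? t
        ... | yes 0<t = inj₂ (maximiser P Q PQ∈X (*-cancelˡ-≡-pos 0<t (proj₁ split)))
        ... | no 0≮t  = inj₁ (≤-antisym (≮⇒≥ 0≮t) 0≤t)

    adjacent-if-maximisers : dot c x ≡ dot c y → Adjacent k x y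
    adjacent-if-maximisers cx≡cy = c , conv-bounded , cx≡cy , conv-maximal
      where
      conv-bounded : ∀ p → InConv k p → dot c p ≤ M
      conv-bounded p (L , as , w≡1 , p≐) = begin
          dot c p               ≡⟨ dot-cong c p≐ ⟩
          dot c (combo L)       ≤⟨ combo-bounded id L as ⟩
          M * weightSum L       ≡⟨ trans (cong (M *_) w≡1) (*-identityʳ M) ⟩
          M                     ∎
        where open ≤-Reasoning
      conv-maximal : ∀ p → InConv k p → dot c p ≡ M → InSegment x y p
      conv-maximal p (L , as , w≡1 , p≐) cp≡M = scaled-1⇒segment (combo-maximal id L as cL≡M) w≡1 p≐
        where
        cL≡M : dot c (combo L) ≡ M * weightSum L
        cL≡M = trans (sym (dot-cong c p≐)) (trans cp≡M (sym (trans (cong (M *_) w≡1) (*-identityʳ M))))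

  vertex∈conv : ∀ {n k} (A B : Subset n) → InX k A B → InConv k x⟨ A , B ⟩
  vertex∈conv A B AB∈X =
    (1ℚ , A , B) ∷ [] , (0≤1 , AB∈X) ∷ [] , refl ,
    λ i j → sym (trans (+-identityʳ _) (*-identityˡ _))

  adjacent⇒exchange∈segment : ∀ {n k} {x y z z′ : Vec² n} → Adjacent k x y →
    InConv k z → InConv k z′ → x ⊕ y ≐ z ⊕ z′ → InSegment x y z
  adjacent⇒exchange∈segment {x = x} {y} {z} {z′} (c , bounded , cx≡cy , face) z∈ z′∈ x⊕y≐z⊕z′ =
    face z z∈ (proj₁ (+-tight (bounded z z∈) (bounded z′ z′∈) sums))
    where
    sums : dot c z + dot c z′ ≡ dot c x + dot c x
    sums = begin
        dot c z + dot c z′   ≡⟨ sym (dot-⊕ c z z′) ⟩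
        dot c (z ⊕ z′)       ≡⟨ dot-cong c (λ i j → sym (x⊕y≐z⊕z′ i j)) ⟩
        dot c (x ⊕ y)        ≡⟨ dot-⊕ c x y ⟩
        dot c x + dot c y    ≡⟨ cong (dot c x +_) (sym cx≡cy) ⟩
        dot c x + dot c x    ∎
      where open ≡-Reasoning

  segment-≡ : ∀ {n} {x y z : Vec² n} {i j i′ j′} → InSegment x y z →
    x i j ≡ x i′ j′ → y i j ≡ y i′ j′ → z i j ≡ z i′ j′
  segment-≡ (t , _ , _ , z≐) x≡ y≡ =
    trans (z≐ _ _) (trans (cong₂ (λ a b → t * a + (1ℚ - t) * b) x≡ y≡) (sym (z≐ _ _)))

  p⊈q⇒∃∉ : ∀ {n} {p q : Subset n} → ¬ p ⊆ q → ∃ λ x → x ∈ p × x ∉ q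
  p⊈q⇒∃∉ {n} {p} {q} p⊈q with ¬∀⟶∃¬ n (λ x → x ∈ p → x ∈ q) (λ x → x ∈? p →-dec x ∈? q) (λ p⊆q → p⊈q (p⊆q _))
  ... | x , x∈p↛x∈q with x ∈? p
  ...   | yes x∈p = x , x∈p , λ x∈q → x∈p↛x∈q (λ _ → x∈q)
  ...   | no x∉p  = contradiction (λ x∈p → contradiction x∈p x∉p) x∈p↛x∈q

  p⊆q⇒∣p∣≡∣q∣⇒p≡q : ∀ {n} {p q : Subset n} → p ⊆ q → ∣ p ∣ ≡ ∣ q ∣ → p ≡ q
  p⊆q⇒∣p∣≡∣q∣⇒p≡q {p = p} {q} p⊆q ∣p∣≡∣q∣ = ⊆-antisym p⊆q q⊆p
    where
    q⊆p : q ⊆ p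
    q⊆p {x} x∈q with x ∈? p
    ... | yes x∈p = x∈p
    ... | no x∉p  = contradiction ∣p∣≡∣q∣ (ℕ.<⇒≢ (p⊂q⇒∣p∣<∣q∣ (p⊆q , x , x∈q , x∉p)))

  1≤∣p∣⇒nonempty : ∀ {n} {p : Subset n} → 1 ℕ.≤ ∣ p ∣ → Nonempty p
  1≤∣p∣⇒nonempty {n} {p} 1≤∣p∣ with nonempty? p
  ... | yes ne = ne
  ... | no ¬ne = contradiction (trans (cong ∣_∣ (Empty-unique ¬ne)) (∣⊥∣≡0 n)) (ℕ.>⇒≢ 1≤∣p∣)

  x∈p⇒⁅x⁆⊆p : ∀ {n} {p : Subset n} {x} → x ∈ p → ⁅ x ⁆ ⊆ p
  x∈p⇒⁅x⁆⊆p {p = p} {x} x∈p y∈⁅x⁆ = subst (_∈ p) (sym (x∈⁅y⁆⇒x≡y x y∈⁅x⁆)) x∈p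

  ∣p∣≡1⇒x≡y : ∀ {n} {p : Subset n} {x y} → ∣ p ∣ ≡ 1 → x ∈ p → y ∈ p → x ≡ y
  ∣p∣≡1⇒x≡y {p = p} {x} {y} ∣p∣≡1 x∈p y∈p = sym (x∈⁅y⁆⇒x≡y x (subst (y ∈_) (sym ⁅x⁆≡p) y∈p))
    where
    ⁅x⁆≡p : ⁅ x ⁆ ≡ p
    ⁅x⁆≡p = p⊆q⇒∣p∣≡∣q∣⇒p≡q (x∈p⇒⁅x⁆⊆p x∈p) (trans (∣⁅x⁆∣≡1 x) (sym ∣p∣≡1))

  ∣p∣≢1⇒another : ∀ {n} {p : Subset n} {x} → ∣ p ∣ ≢ 1 → x ∈ p → ∃ λ y → y ∈ p × y ≢ x
  ∣p∣≢1⇒another {p = p} {x} ∣p∣≢1 x∈p with p ⊆? ⁅ x ⁆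
  ... | yes p⊆⁅x⁆ = contradiction (trans (cong ∣_∣ (⊆-antisym p⊆⁅x⁆ (x∈p⇒⁅x⁆⊆p x∈p))) (∣⁅x⁆∣≡1 x)) ∣p∣≢1
  ... | no p⊈⁅x⁆ with p⊈q⇒∃∉ p⊈⁅x⁆
  ...   | y , y∈p , y∉⁅x⁆ = y , y∈p , x∉⁅y⁆⇒x≢y y∉⁅x⁆

  x∈p─q⇒x∉q : ∀ {n} {p q : Subset n} {x} → x ∈ p ─ q → x ∉ q
  x∈p─q⇒x∉q {p = _ ∷ _} {inside  ∷ _} (there x∈p─q) (there x∈q) = x∈p─q⇒x∉q x∈p─q x∈q
  x∈p─q⇒x∉q {p = _ ∷ _} {outside ∷ _} (there x∈p─q) (there x∈q) = x∈p─q⇒x∉q x∈p─q x∈q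

  ∣p─p∣≢1 : ∀ {n} (p : Subset n) → ∣ p ─ p ∣ ≢ 1
  ∣p─p∣≢1 p ∣p─p∣≡1 with 1≤∣p∣⇒nonempty {p = p ─ p} (ℕ.≤-reflexive (sym ∣p─p∣≡1))
  ... | x , x∈p─p = x∈p─q⇒x∉q x∈p─p (p─q⊆p p p x∈p─p)

  only-outsider⇒⊆ : ∀ {n} {p q r : Subset n} {x} → ∣ p ─ q ∣ ≡ 1 → x ∈ p → x ∉ q → x ∈ r →
    (∀ {y} → y ∈ p → y ∈ q → y ∈ r) → p ⊆ r
  only-outsider⇒⊆ {q = q} {r} ∣p─q∣≡1 x∈p x∉q x∈r p∩q⊆r {y} y∈p with y ∈? q
  ... | yes y∈q = p∩q⊆r y∈p y∈q
  ... | no y∉q  = subst (_∈ r) (∣p∣≡1⇒x≡y ∣p─q∣≡1 (x∈p∧x∉q⇒x∈p─q x∈p x∉q) (x∈p∧x∉q⇒x∈p─q y∈p y∉q)) x∈r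

  -- Rectangles between two vertices

  EdgeCondition : ∀ {n} (A B A′ B′ : Subset n) → Set
  EdgeCondition A B A′ B′ =
    (A ≢ A′ × B ≢ B′) ⊎ (A ≡ A′ × ∣ B ─ B′ ∣ ≡ 1) ⊎ (B ≡ B′ × ∣ A ─ A′ ∣ ≡ 1)

  EdgeCondition-transpose : ∀ {n} {A B A′ B′ : Subset n} → EdgeCondition A B A′ B′ → EdgeCondition B A B′ A′
  EdgeCondition-transpose (inj₁ (A≢A′ , B≢B′)) = inj₁ (B≢B′ , A≢A′)
  EdgeCondition-transpose (inj₂ (inj₁ rows))   = inj₂ (inj₂ rows)
  EdgeCondition-transpose (inj₂ (inj₂ cols))   = inj₂ (inj₁ cols)

  EdgeCondition⇒∣A─A′∣≡1 : ∀ {n} {A B A′ B′ : Subset n} → EdgeCondition A B A′ B′ → B ≡ B′ → ∣ A ─ A′ ∣ ≡ 1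
  EdgeCondition⇒∣A─A′∣≡1 (inj₁ (_ , B≢B′))                     B≡B′ = contradiction B≡B′ B≢B′
  EdgeCondition⇒∣A─A′∣≡1 {B = B} (inj₂ (inj₁ (_ , ∣B─B′∣≡1))) refl = contradiction ∣B─B′∣≡1 (∣p─p∣≢1 B)
  EdgeCondition⇒∣A─A′∣≡1 (inj₂ (inj₂ (_ , ∣A─A′∣≡1)))          _    = ∣A─A′∣≡1

  record Sandwiched {n} (k : ℕ) (A B A′ B′ P Q : Subset n) : Set where
    field
      1≤k      : 1 ℕ.≤ k
      AB∈X     : InX k A B
      A′B′∈X   : InX k A′ B′
      PQ∈X     : InX k P Q
      edge     : EdgeCondition A B A′ B′
      covered  : ∀ {i j} → i ∈ P → j ∈ Q → (i ∈ A × j ∈ B) ⊎ (i ∈ A′ × j ∈ B′)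
      contains : ∀ {i j} → i ∈ A → j ∈ B → i ∈ A′ → j ∈ B′ → i ∈ P × j ∈ Q

  Sandwiched-transpose : ∀ {n k} {A B A′ B′ P Q : Subset n} → Sandwiched k A B A′ B′ P Q → Sandwiched k B A B′ A′ Q P
  Sandwiched-transpose s = record
    { 1≤k      = 1≤k
    ; AB∈X     = swap AB∈X
    ; A′B′∈X   = swap A′B′∈X
    ; PQ∈X     = swap PQ∈X
    ; edge     = EdgeCondition-transpose edge
    ; covered  = λ i∈Q j∈P → Sum.map swap swap (covered j∈P i∈Q)
    ; contains = λ i∈B j∈A i∈B′ j∈A′ → swap (contains j∈A i∈B j∈A′ i∈B′)
    }
    where open Sandwiched s

  second-if-P⊈A : ∀ {n k} {A B A′ B′ P Q : Subset n} → Sandwiched k A B A′ B′ P Q →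
    ∀ {p} → p ∈ P → p ∉ A → P ≡ A′ × Q ≡ B′
  second-if-P⊈A {A = A} {B} {A′} {B′} {P} {Q} s {p} p∈P p∉A = P≡A′ , Q≡B′
    where
    open Sandwiched s
    second : ∀ {j} → j ∈ Q → p ∈ A′ × j ∈ B′
    second j∈Q = [ (λ (p∈A , _) → contradiction p∈A p∉A) , id ]′ (covered p∈P j∈Q)

    Q≡B′ : Q ≡ B′
    Q≡B′ = p⊆q⇒∣p∣≡∣q∣⇒p≡q (proj₂ ∘ second) (trans (proj₂ PQ∈X) (sym (proj₂ A′B′∈X)))

    Q-nonempty : Nonempty Q
    Q-nonempty = 1≤∣p∣⇒nonempty (subst (1 ℕ.≤_) (sym (proj₂ PQ∈X)) 1≤k)
    j₀∈Q = proj₂ Q-nonempty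

    -- A row i ∈ P ∖ A′ would be the unique row of A ∖ A′, and then A ⊂ P.
    P⊆A′-if-Q⊆B : Q ⊆ B → P ⊆ A′
    P⊆A′-if-Q⊆B Q⊆B {i} i∈P with i ∈? A′
    ... | yes i∈A′ = i∈A′
    ... | no i∉A′ =
      contradiction (trans (proj₁ AB∈X) (sym (proj₁ PQ∈X))) (ℕ.<⇒≢ (p⊂q⇒∣p∣<∣q∣ (A⊆P , p , p∈P , p∉A)))
      where
      B≡B′ : B ≡ B′
      B≡B′ = trans (sym (p⊆q⇒∣p∣≡∣q∣⇒p≡q Q⊆B (trans (proj₂ PQ∈X) (sym (proj₂ AB∈X))))) Q≡B′
      i∈A : i ∈ A
      i∈A = [ proj₁ , (λ (i∈A′ , _) → contradiction i∈A′ i∉A′) ]′ (covered i∈P j₀∈Q)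
      A⊆P : A ⊆ P
      A⊆P = only-outsider⇒⊆ (EdgeCondition⇒∣A─A′∣≡1 edge B≡B′) i∈A i∉A′ i∈P
        (λ m∈A m∈A′ → proj₁ (contains m∈A (Q⊆B j₀∈Q) m∈A′ (proj₂ (second j₀∈Q))))

    P⊆A′ : P ⊆ A′
    P⊆A′ with Q ⊆? B
    ... | yes Q⊆B = P⊆A′-if-Q⊆B Q⊆B
    ... | no Q⊈B with p⊈q⇒∃∉ Q⊈B
    ...   | q , q∈Q , q∉B = λ i∈P → [ (λ (_ , q∈B) → contradiction q∈B q∉B) , proj₁ ]′ (covered i∈P q∈Q)

    P≡A′ : P ≡ A′
    P≡A′ = p⊆q⇒∣p∣≡∣q∣⇒p≡q P⊆A′ (trans (proj₁ PQ∈X) (sym (proj₁ A′B′∈X)))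

  Sandwiched⇒vertex : ∀ {n k} {A B A′ B′ P Q : Subset n} → Sandwiched k A B A′ B′ P Q →
    (P ≡ A × Q ≡ B) ⊎ (P ≡ A′ × Q ≡ B′)
  Sandwiched⇒vertex {A = A} {B} {P = P} {Q} s with P ⊆? A | Q ⊆? B
  ... | no P⊈A | _ with p⊈q⇒∃∉ P⊈A
  ...   | p , p∈P , p∉A = inj₂ (second-if-P⊈A s p∈P p∉A)
  Sandwiched⇒vertex s | yes _ | no Q⊈B with p⊈q⇒∃∉ Q⊈B
  ...   | q , q∈Q , q∉B = inj₂ (swap (second-if-P⊈A (Sandwiched-transpose s) q∈Q q∉B))
  Sandwiched⇒vertex s | yes P⊆A | yes Q⊆B = inj₁
    ( p⊆q⇒∣p∣≡∣q∣⇒p≡q P⊆A (trans (proj₁ PQ∈X) (sym (proj₁ AB∈X)))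
    , p⊆q⇒∣p∣≡∣q∣⇒p≡q Q⊆B (trans (proj₂ PQ∈X) (sym (proj₂ AB∈X))) )
    where open Sandwiched s

  -- The functional x + y

  cell-≤ : ∀ a b z → (⟦ a ⟧ + ⟦ b ⟧) * ⟦ z ⟧ ≤ ⟦ z ⟧ + ⟦ a ⟧ * ⟦ b ⟧
  cell-≤ false false false = ≤-refl
  cell-≤ false true  false = ≤-refl
  cell-≤ true  false false = ≤-refl
  cell-≤ true  true  false = 0≤1
  cell-≤ false false true  = 0≤1
  cell-≤ false true  true  = ≤-refl
  cell-≤ true  false true  = ≤-refl
  cell-≤ true  true  true  = ≤-refl

  cell-≡ˡ : ∀ a b → (⟦ a ⟧ + ⟦ b ⟧) * ⟦ a ⟧ ≡ ⟦ a ⟧ + ⟦ a ⟧ * ⟦ b ⟧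
  cell-≡ˡ false false = refl
  cell-≡ˡ false true  = refl
  cell-≡ˡ true  false = refl
  cell-≡ˡ true  true  = refl

  cell-≡ʳ : ∀ a b → (⟦ a ⟧ + ⟦ b ⟧) * ⟦ b ⟧ ≡ ⟦ b ⟧ + ⟦ a ⟧ * ⟦ b ⟧
  cell-≡ʳ false false = refl
  cell-≡ʳ false true  = refl
  cell-≡ʳ true  false = refl
  cell-≡ʳ true  true  = refl

  cell-tight : ∀ a b z → (⟦ a ⟧ + ⟦ b ⟧) * ⟦ z ⟧ ≡ ⟦ z ⟧ + ⟦ a ⟧ * ⟦ b ⟧ →
    (z ≡ true → a ≡ true ⊎ b ≡ true) × (a ≡ true → b ≡ true → z ≡ true)
  cell-tight false false false _ = (λ ()) , λ ()
  cell-tight false true  false _ = (λ ()) , λ ()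
  cell-tight true  false false _ = (λ ()) , λ _ ()
  cell-tight true  true  false ()
  cell-tight false false true  ()
  cell-tight false true  true  _ = (λ _ → inj₂ refl) , λ ()
  cell-tight true  false true  _ = (λ _ → inj₁ refl) , λ _ ()
  cell-tight true  true  true  _ = (λ _ → inj₁ refl) , λ _ _ → refl

  ∈×∈⇒∧ : ∀ {n} {A B : Subset n} {i j} → i ∈ A → j ∈ B → lookup A i ∧ lookup B j ≡ true
  ∈×∈⇒∧ i∈A j∈B = cong₂ _∧_ ([]=⇒lookup i∈A) ([]=⇒lookup j∈B)

  ∧⇒∈×∈ : ∀ {n} {A B : Subset n} {i j} → lookup A i ∧ lookup B j ≡ true → i ∈ A × j ∈ B
  ∧⇒∈×∈ {A = A} {B} {i} {j} eq = lookup⇒[]= i A (∧-conicalˡ _ _ eq) , lookup⇒[]= j B (∧-conicalʳ _ _ eq)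

  vertex-cong : ∀ {n} {P Q A B : Subset n} → P ≡ A → Q ≡ B → x⟨ P , Q ⟩ ≐ x⟨ A , B ⟩
  vertex-cong refl refl _ _ = refl

  Σ²-vertex-k : ∀ {n k} (P Q : Subset n) → InX k P Q → Σ² x⟨ P , Q ⟩ ≡ fromℕ k * fromℕ k
  Σ²-vertex-k P Q (∣P∣≡k , ∣Q∣≡k) = trans (Σ²-vertex P Q) (cong₂ (λ a b → fromℕ a * fromℕ b) ∣P∣≡k ∣Q∣≡k)

  module SumFunctional {n k} (A B A′ B′ : Subset n) (AB∈X : InX k A B) (A′B′∈X : InX k A′ B′) where

    x y c : Vec² n
    x = x⟨ A , B ⟩
    y = x⟨ A′ , B′ ⟩
    c = x ⊕ y

    cell-bound : ∀ P Q i j → (c ⊗ x⟨ P , Q ⟩) i j ≤ (x⟨ P , Q ⟩ ⊕ x ⊗ y) i j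
    cell-bound P Q i j = cell-≤ (lookup A i ∧ lookup B j) (lookup A′ i ∧ lookup B′ j) (lookup P i ∧ lookup Q j)

    Σ²-bound : ∀ P Q → InX k P Q → Σ² (x⟨ P , Q ⟩ ⊕ x ⊗ y) ≡ fromℕ k * fromℕ k + Σ² (x ⊗ y)
    Σ²-bound P Q PQ∈X = trans (Σ²-⊕ x⟨ P , Q ⟩ (x ⊗ y)) (cong (_+ Σ² (x ⊗ y)) (Σ²-vertex-k P Q PQ∈X))

    dot-c-x : dot c x ≡ fromℕ k * fromℕ k + Σ² (x ⊗ y)
    dot-c-x = trans (Σ²-cong λ i j → cell-≡ˡ (lookup A i ∧ lookup B j) (lookup A′ i ∧ lookup B′ j)) (Σ²-bound A B AB∈X)

    dot-c-x≡y : dot c x ≡ dot c y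
    dot-c-x≡y = trans dot-c-x (sym (trans
      (Σ²-cong λ i j → cell-≡ʳ (lookup A i ∧ lookup B j) (lookup A′ i ∧ lookup B′ j)) (Σ²-bound A′ B′ A′B′∈X)))

    bounded : ∀ P Q → InX k P Q → dot c x⟨ P , Q ⟩ ≤ dot c x
    bounded P Q PQ∈X = ≤-trans (Σ²-mono (cell-bound P Q)) (≤-reflexive (trans (Σ²-bound P Q PQ∈X) (sym dot-c-x)))

    tight : ∀ P Q → InX k P Q → dot c x⟨ P , Q ⟩ ≡ dot c x → c ⊗ x⟨ P , Q ⟩ ≐ x⟨ P , Q ⟩ ⊕ x ⊗ y
    tight P Q PQ∈X opt = Σ²-tight (cell-bound P Q) (trans opt (trans dot-c-x (sym (Σ²-bound P Q PQ∈X))))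

    maximiser : 1 ℕ.≤ k → EdgeCondition A B A′ B′ →
      ∀ P Q → InX k P Q → dot c x⟨ P , Q ⟩ ≡ dot c x → x⟨ P , Q ⟩ ≐ x ⊎ x⟨ P , Q ⟩ ≐ y
    maximiser 1≤k edge P Q PQ∈X opt =
      Sum.map (uncurry vertex-cong) (uncurry vertex-cong) (Sandwiched⇒vertex sandwiched)
      where
      cell : ∀ i j →
        (lookup P i ∧ lookup Q j ≡ true → lookup A i ∧ lookup B j ≡ true ⊎ lookup A′ i ∧ lookup B′ j ≡ true) ×
        (lookup A i ∧ lookup B j ≡ true → lookup A′ i ∧ lookup B′ j ≡ true → lookup P i ∧ lookup Q j ≡ true)
      cell i j = cell-tight _ _ _ (tight P Q PQ∈X opt i j)
      sandwiched : Sandwiched k A B A′ B′ P Q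
      sandwiched = record
        { 1≤k      = 1≤k
        ; AB∈X     = AB∈X
        ; A′B′∈X   = A′B′∈X
        ; PQ∈X     = PQ∈X
        ; edge     = edge
        ; covered  = λ {i} {j} i∈P j∈Q → Sum.map ∧⇒∈×∈ ∧⇒∈×∈ (proj₁ (cell i j) (∈×∈⇒∧ i∈P j∈Q))
        ; contains = λ {i} {j} i∈A j∈B i∈A′ j∈B′ → ∧⇒∈×∈ (proj₂ (cell i j) (∈×∈⇒∧ i∈A j∈B) (∈×∈⇒∧ i∈A′ j∈B′))
        }

  edge⇒adjacent : ∀ {n k} {A B A′ B′ : Subset n} → 1 ℕ.≤ k → InX k A B → InX k A′ B′ →
    EdgeCondition A B A′ B′ → Adjacent k x⟨ A , B ⟩ x⟨ A′ , B′ ⟩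
  edge⇒adjacent {A = A} {B} {A′} {B′} 1≤k AB∈X A′B′∈X edge =
    adjacent-if-maximisers c x y bounded (maximiser 1≤k edge) dot-c-x≡y
    where open SumFunctional A B A′ B′ AB∈X A′B′∈X

  -- Exchanging one element between two subsets

  x∈p∧y∉p⇒x≢y : ∀ {n} {p : Subset n} {x y} → x ∈ p → y ∉ p → x ≢ y
  x∈p∧y∉p⇒x≢y x∈p y∉p refl = y∉p x∈p

  x∉p⇒lookup≡outside : ∀ {n} {p : Subset n} {x} → x ∉ p → lookup p x ≡ outside
  x∉p⇒lookup≡outside {p = p} {x} x∉p with lookup p x in eq
  ... | true  = contradiction (lookup⇒[]= x p eq) x∉p
  ... | false = refl

  x∈p⇒∣p∣≡suc∣p[x]≔outside∣ : ∀ {n} {p : Subset n} {x} → x ∈ p → ∣ p ∣ ≡ suc ∣ p [ x ]≔ outside ∣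
  x∈p⇒∣p∣≡suc∣p[x]≔outside∣ here = refl
  x∈p⇒∣p∣≡suc∣p[x]≔outside∣ {p = inside  ∷ _} (there x∈p) = cong suc (x∈p⇒∣p∣≡suc∣p[x]≔outside∣ x∈p)
  x∈p⇒∣p∣≡suc∣p[x]≔outside∣ {p = outside ∷ _} (there x∈p) = x∈p⇒∣p∣≡suc∣p[x]≔outside∣ x∈p

  x∉p⇒∣p[x]≔inside∣≡suc∣p∣ : ∀ {n} {p : Subset n} {x} → x ∉ p → ∣ p [ x ]≔ inside ∣ ≡ suc ∣ p ∣
  x∉p⇒∣p[x]≔inside∣≡suc∣p∣ {p = inside  ∷ _} {zero}  x∉p = contradiction here x∉p
  x∉p⇒∣p[x]≔inside∣≡suc∣p∣ {p = outside ∷ _} {zero}  x∉p = refl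
  x∉p⇒∣p[x]≔inside∣≡suc∣p∣ {p = inside  ∷ _} {suc x} x∉p = cong suc (x∉p⇒∣p[x]≔inside∣≡suc∣p∣ (x∉p ∘ there))
  x∉p⇒∣p[x]≔inside∣≡suc∣p∣ {p = outside ∷ _} {suc x} x∉p = x∉p⇒∣p[x]≔inside∣≡suc∣p∣ (x∉p ∘ there)

  exchange : ∀ {n} → Subset n → Fin n → Fin n → Subset n
  exchange S u v = (S [ u ]≔ outside) [ v ]≔ inside

  module _ {n} {S : Subset n} {u v : Fin n} (u∈S : u ∈ S) (v∉S : v ∉ S) where

    lookup-exchange-u : lookup (exchange S u v) u ≡ outside
    lookup-exchange-u =
      trans (lookup∘update′ (x∈p∧y∉p⇒x≢y u∈S v∉S) (S [ u ]≔ outside) inside) (lookup∘update u S outside)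

    lookup-exchange-v : lookup (exchange S u v) v ≡ inside
    lookup-exchange-v = lookup∘update v (S [ u ]≔ outside) inside

    lookup-exchange-other : ∀ {j} → j ≢ u → j ≢ v → lookup (exchange S u v) j ≡ lookup S j
    lookup-exchange-other j≢u j≢v = trans (lookup∘update′ j≢v (S [ u ]≔ outside) inside) (lookup∘update′ j≢u S outside)

    ∣exchange∣ : ∣ exchange S u v ∣ ≡ ∣ S ∣
    ∣exchange∣ = trans (x∉p⇒∣p[x]≔inside∣≡suc∣p∣ v∉S[u]≔outside) (sym (x∈p⇒∣p∣≡suc∣p[x]≔outside∣ u∈S))
      where
      v∉S[u]≔outside : v ∉ S [ u ]≔ outside
      v∉S[u]≔outside v∈ = v∉S (lookup⇒[]= v S
        (trans (sym (lookup∘update′ (x∈p∧y∉p⇒x≢y u∈S v∉S ∘ sym) S outside)) ([]=⇒lookup v∈)))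

  indicator-swap : ∀ {a a′ b b′} → a ≡ true → a′ ≡ false → b ≡ false → b′ ≡ true → ⟦ a ⟧ + ⟦ a′ ⟧ ≡ ⟦ b ⟧ + ⟦ b′ ⟧
  indicator-swap refl refl refl refl = +-comm 1ℚ 0ℚ

  record Exchangeable {n} (S S′ : Subset n) : Set where
    field
      u u′ v : Fin n
      u∈S    : u ∈ S
      u∉S′   : u ∉ S′
      u′∈S   : u′ ∈ S
      u′∉S′  : u′ ∉ S′
      u′≢u   : u′ ≢ u
      v∈S′   : v ∈ S′
      v∉S    : v ∉ S

    W W′ : Subset n
    W  = exchange S u v
    W′ = exchange S′ v u

    ∣W∣≡∣S∣ : ∣ W ∣ ≡ ∣ S ∣
    ∣W∣≡∣S∣ = ∣exchange∣ u∈S v∉S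

    ∣W′∣≡∣S′∣ : ∣ W′ ∣ ≡ ∣ S′ ∣
    ∣W′∣≡∣S′∣ = ∣exchange∣ v∈S′ u∉S′

    u∉W : u ∉ W
    u∉W u∈W with () ← trans (sym (lookup-exchange-u u∈S v∉S)) ([]=⇒lookup u∈W)

    u′∈W : u′ ∈ W
    u′∈W = lookup⇒[]= u′ W
      (trans (lookup-exchange-other u∈S v∉S u′≢u (x∈p∧y∉p⇒x≢y u′∈S v∉S)) ([]=⇒lookup u′∈S))

    indicators : ∀ j → ⟦ lookup S j ⟧ + ⟦ lookup S′ j ⟧ ≡ ⟦ lookup W j ⟧ + ⟦ lookup W′ j ⟧
    indicators j with j ≟ u | j ≟ v
    ... | yes refl | _ = indicator-swap ([]=⇒lookup u∈S) (x∉p⇒lookup≡outside u∉S′)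
                           (lookup-exchange-u u∈S v∉S) (lookup-exchange-v v∈S′ u∉S′)
    ... | no _ | yes refl = sym (indicator-swap (lookup-exchange-v u∈S v∉S) (lookup-exchange-u v∈S′ u∉S′)
                                  (x∉p⇒lookup≡outside v∉S) ([]=⇒lookup v∈S′))
    ... | no j≢u | no j≢v = sym (cong₂ (λ a b → ⟦ a ⟧ + ⟦ b ⟧)
                                  (lookup-exchange-other u∈S v∉S j≢u j≢v) (lookup-exchange-other v∈S′ u∉S′ j≢v j≢u))

  exchangeable : ∀ {n} {S S′ : Subset n} → ∣ S ∣ ≡ ∣ S′ ∣ → S ≢ S′ → ∣ S ─ S′ ∣ ≢ 1 → Exchangeable S S′
  exchangeable {S = S} {S′} ∣S∣≡∣S′∣ S≢S′ ∣S─S′∣≢1 with S ⊆? S′ | S′ ⊆? S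
  ... | yes S⊆S′ | _ = contradiction (p⊆q⇒∣p∣≡∣q∣⇒p≡q S⊆S′ ∣S∣≡∣S′∣) S≢S′
  ... | no _ | yes S′⊆S = contradiction (sym (p⊆q⇒∣p∣≡∣q∣⇒p≡q S′⊆S (sym ∣S∣≡∣S′∣))) S≢S′
  ... | no S⊈S′ | no S′⊈S with p⊈q⇒∃∉ S⊈S′ | p⊈q⇒∃∉ S′⊈S
  ... | u , u∈S , u∉S′ | v , v∈S′ , v∉S with ∣p∣≢1⇒another ∣S─S′∣≢1 (x∈p∧x∉q⇒x∈p─q u∈S u∉S′)
  ... | u′ , u′∈S─S′ , u′≢u = record
    { u = u ; u′ = u′ ; v = v
    ; u∈S = u∈S ; u∉S′ = u∉S′
    ; u′∈S = p─q⊆p S S′ u′∈S─S′ ; u′∉S′ = x∈p─q⇒x∉q u′∈S─S′ ; u′≢u = u′≢u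
    ; v∈S′ = v∈S′ ; v∉S = v∉S
    }

  vertex-entry-1 : ∀ {n} {A B : Subset n} {i j} → i ∈ A → j ∈ B → x⟨ A , B ⟩ i j ≡ 1ℚ
  vertex-entry-1 i∈A j∈B = cong ⟦_⟧ (∈×∈⇒∧ i∈A j∈B)

  vertex-entry-0ˡ : ∀ {n} {A : Subset n} {i} (B : Subset n) j → i ∉ A → x⟨ A , B ⟩ i j ≡ 0ℚ
  vertex-entry-0ˡ _ _ i∉A rewrite x∉p⇒lookup≡outside i∉A = refl

  vertex-entry-0ʳ : ∀ {n} {B : Subset n} {j} (A : Subset n) i → j ∉ B → x⟨ A , B ⟩ i j ≡ 0ℚ
  vertex-entry-0ʳ A i j∉B
    rewrite x∉p⇒lookup≡outside j∉B = cong ⟦_⟧ (∧-zeroʳ (lookup A i))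

  vertex-⊕ʳ : ∀ {n} (A B B′ W W′ : Subset n) →
    (∀ j → ⟦ lookup B j ⟧ + ⟦ lookup B′ j ⟧ ≡ ⟦ lookup W j ⟧ + ⟦ lookup W′ j ⟧) →
    x⟨ A , B ⟩ ⊕ x⟨ A , B′ ⟩ ≐ x⟨ A , W ⟩ ⊕ x⟨ A , W′ ⟩
  vertex-⊕ʳ A B B′ W W′ sums i j = begin
      ⟦ a ∧ lookup B j ⟧ + ⟦ a ∧ lookup B′ j ⟧
    ≡⟨ cong₂ _+_ (⟦∧⟧ a (lookup B j)) (⟦∧⟧ a (lookup B′ j)) ⟩
      ⟦ a ⟧ * ⟦ lookup B j ⟧ + ⟦ a ⟧ * ⟦ lookup B′ j ⟧
    ≡⟨ sym (*-distribˡ-+ ⟦ a ⟧ ⟦ lookup B j ⟧ ⟦ lookup B′ j ⟧) ⟩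
      ⟦ a ⟧ * (⟦ lookup B j ⟧ + ⟦ lookup B′ j ⟧)
    ≡⟨ cong (⟦ a ⟧ *_) (sums j) ⟩
      ⟦ a ⟧ * (⟦ lookup W j ⟧ + ⟦ lookup W′ j ⟧)
    ≡⟨ *-distribˡ-+ ⟦ a ⟧ ⟦ lookup W j ⟧ ⟦ lookup W′ j ⟧ ⟩
      ⟦ a ⟧ * ⟦ lookup W j ⟧ + ⟦ a ⟧ * ⟦ lookup W′ j ⟧
    ≡⟨ sym (cong₂ _+_ (⟦∧⟧ a (lookup W j)) (⟦∧⟧ a (lookup W′ j))) ⟩
      ⟦ a ∧ lookup W j ⟧ + ⟦ a ∧ lookup W′ j ⟧
    ∎
    where
    open ≡-Reasoning
    a = lookup A i

  vertex-⊕ˡ : ∀ {n} (A A′ W W′ B : Subset n) →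
    (∀ i → ⟦ lookup A i ⟧ + ⟦ lookup A′ i ⟧ ≡ ⟦ lookup W i ⟧ + ⟦ lookup W′ i ⟧) →
    x⟨ A , B ⟩ ⊕ x⟨ A′ , B ⟩ ≐ x⟨ W , B ⟩ ⊕ x⟨ W′ , B ⟩
  vertex-⊕ˡ A A′ W W′ B sums i j = begin
      ⟦ lookup A i ∧ b ⟧ + ⟦ lookup A′ i ∧ b ⟧
    ≡⟨ cong₂ _+_ (⟦∧⟧ (lookup A i) b) (⟦∧⟧ (lookup A′ i) b) ⟩
      ⟦ lookup A i ⟧ * ⟦ b ⟧ + ⟦ lookup A′ i ⟧ * ⟦ b ⟧
    ≡⟨ sym (*-distribʳ-+ ⟦ b ⟧ ⟦ lookup A i ⟧ ⟦ lookup A′ i ⟧) ⟩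
      (⟦ lookup A i ⟧ + ⟦ lookup A′ i ⟧) * ⟦ b ⟧
    ≡⟨ cong (_* ⟦ b ⟧) (sums i) ⟩
      (⟦ lookup W i ⟧ + ⟦ lookup W′ i ⟧) * ⟦ b ⟧
    ≡⟨ *-distribʳ-+ ⟦ b ⟧ ⟦ lookup W i ⟧ ⟦ lookup W′ i ⟧ ⟩
      ⟦ lookup W i ⟧ * ⟦ b ⟧ + ⟦ lookup W′ i ⟧ * ⟦ b ⟧
    ≡⟨ sym (cong₂ _+_ (⟦∧⟧ (lookup W i) b) (⟦∧⟧ (lookup W′ i) b)) ⟩
      ⟦ lookup W i ∧ b ⟧ + ⟦ lookup W′ i ∧ b ⟧
    ∎
    where
    open ≡-Reasoning
    b = lookup B j

  exchange⇒¬adjacent : ∀ {n k} {x y z z′ : Vec² n} (i j i′ j′ : Fin n) → InConv k z → InConv k z′ → x ⊕ y ≐ z ⊕ z′ →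
    x i j ≡ x i′ j′ → y i j ≡ y i′ j′ → z i j ≢ z i′ j′ → ¬ Adjacent k x y
  exchange⇒¬adjacent _ _ _ _ z∈ z′∈ x⊕y≐z⊕z′ x≡ y≡ z≢ adj =
    z≢ (segment-≡ (adjacent⇒exchange∈segment adj z∈ z′∈ x⊕y≐z⊕z′) x≡ y≡)

  0≢1 : 0ℚ ≢ 1ℚ
  0≢1 ()

  same-rows⇒¬adjacent : ∀ {n k} {A B B′ : Subset n} → 1 ℕ.≤ k → InX k A B → InX k A B′ →
    B ≢ B′ → ∣ B ─ B′ ∣ ≢ 1 → ¬ Adjacent k x⟨ A , B ⟩ x⟨ A , B′ ⟩
  same-rows⇒¬adjacent {A = A} {B} {B′} 1≤k (∣A∣≡k , ∣B∣≡k) (_ , ∣B′∣≡k) B≢B′ ∣B─B′∣≢1 =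
    exchange⇒¬adjacent a u a u′
      (vertex∈conv A W (∣A∣≡k , trans ∣W∣≡∣S∣ ∣B∣≡k)) (vertex∈conv A W′ (∣A∣≡k , trans ∣W′∣≡∣S′∣ ∣B′∣≡k))
      (vertex-⊕ʳ A B B′ W W′ indicators)
      (trans (vertex-entry-1 a∈A u∈S) (sym (vertex-entry-1 a∈A u′∈S)))
      (trans (vertex-entry-0ʳ A a u∉S′) (sym (vertex-entry-0ʳ A a u′∉S′)))
      (λ eq → 0≢1 (trans (sym (vertex-entry-0ʳ A a u∉W)) (trans eq (vertex-entry-1 a∈A u′∈W))))
    where
    open Exchangeable (exchangeable (trans ∣B∣≡k (sym ∣B′∣≡k)) B≢B′ ∣B─B′∣≢1)
    A-nonempty : Nonempty A
    A-nonempty = 1≤∣p∣⇒nonempty (subst (1 ℕ.≤_) (sym ∣A∣≡k) 1≤k)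
    a = proj₁ A-nonempty
    a∈A = proj₂ A-nonempty

  same-columns⇒¬adjacent : ∀ {n k} {A A′ B : Subset n} → 1 ℕ.≤ k → InX k A B → InX k A′ B →
    A ≢ A′ → ∣ A ─ A′ ∣ ≢ 1 → ¬ Adjacent k x⟨ A , B ⟩ x⟨ A′ , B ⟩
  same-columns⇒¬adjacent {A = A} {A′} {B} 1≤k (∣A∣≡k , ∣B∣≡k) (∣A′∣≡k , _) A≢A′ ∣A─A′∣≢1 =
    exchange⇒¬adjacent u b u′ b
      (vertex∈conv W B (trans ∣W∣≡∣S∣ ∣A∣≡k , ∣B∣≡k)) (vertex∈conv W′ B (trans ∣W′∣≡∣S′∣ ∣A′∣≡k , ∣B∣≡k))
      (vertex-⊕ˡ A A′ W W′ B indicators)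
      (trans (vertex-entry-1 u∈S b∈B) (sym (vertex-entry-1 u′∈S b∈B)))
      (trans (vertex-entry-0ˡ B b u∉S′) (sym (vertex-entry-0ˡ B b u′∉S′)))
      (λ eq → 0≢1 (trans (sym (vertex-entry-0ˡ B b u∉W)) (trans eq (vertex-entry-1 u′∈W b∈B))))
    where
    open Exchangeable (exchangeable (trans ∣A∣≡k (sym ∣A′∣≡k)) A≢A′ ∣A─A′∣≢1)
    B-nonempty : Nonempty B
    B-nonempty = 1≤∣p∣⇒nonempty (subst (1 ℕ.≤_) (sym ∣B∣≡k) 1≤k)
    b = proj₁ B-nonempty
    b∈B = proj₂ B-nonempty

  adjacent⇒edge : ∀ {n k} {A B A′ B′ : Subset n} → 1 ℕ.≤ k → InX k A B → InX k A′ B′ →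
    ¬ x⟨ A , B ⟩ ≐ x⟨ A′ , B′ ⟩ → Adjacent k x⟨ A , B ⟩ x⟨ A′ , B′ ⟩ → EdgeCondition A B A′ B′
  adjacent⇒edge {A = A} {B} {A′} {B′} 1≤k AB∈X A′B′∈X x≢y adj
    with ≡-dec Bool._≟_ A A′ | ≡-dec Bool._≟_ B B′
  ... | no A≢A′ | no B≢B′ = inj₁ (A≢A′ , B≢B′)
  ... | yes refl | yes refl = contradiction (λ _ _ → refl) x≢y
  ... | yes refl | no B≢B′ with ∣ B ─ B′ ∣ ℕ.≟ 1
  ...   | yes ∣B─B′∣≡1 = inj₂ (inj₁ (refl , ∣B─B′∣≡1))
  ...   | no ∣B─B′∣≢1  = contradiction adj (same-rows⇒¬adjacent {A = A} 1≤k AB∈X A′B′∈X B≢B′ ∣B─B′∣≢1)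
  adjacent⇒edge {A = A} {B} {A′} 1≤k AB∈X A′B′∈X _ adj | no A≢A′ | yes refl with ∣ A ─ A′ ∣ ℕ.≟ 1
  ...   | yes ∣A─A′∣≡1 = inj₂ (inj₂ (refl , ∣A─A′∣≡1))
  ...   | no ∣A─A′∣≢1  = contradiction adj (same-columns⇒¬adjacent {B = B} 1≤k AB∈X A′B′∈X A≢A′ ∣A─A′∣≢1)

open import Defs
open import Data.Nat using (ℕ; _≤_; _≥_)
open import Data.Fin.Subset using (Subset; ∣_∣; _─_)
open import Data.Product using (_×_)
open import Data.Sum using (_⊎_)
open import Relation.Nullary using (¬_)
open import Relation.Binary.PropositionalEquality using (_≡_; _≢_)
open import Function.Bundles using (_⇔_; mk⇔)
open BicliquePolytope using (edge⇒adjacent; adjacent⇒edge)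

lemma2 : (n k : ℕ) → n ≥ 1 → 1 ≤ k → k ≤ n →
    (A B A′ B′ : Subset n) → InX k A B → InX k A′ B′ →
    ¬ (∀ i j → x⟨ A , B ⟩ i j ≡ x⟨ A′ , B′ ⟩ i j) →
    Adjacent k x⟨ A , B ⟩ x⟨ A′ , B′ ⟩ ⇔
      ((A ≢ A′ × B ≢ B′)
       ⊎ (A ≡ A′ × ∣ B ─ B′ ∣ ≡ 1)
       ⊎ (B ≡ B′ × ∣ A ─ A′ ∣ ≡ 1))
lemma2 n k _ 1≤k _ A B A′ B′ AB∈X A′B′∈X x≢y =
  mk⇔ (adjacent⇒edge 1≤k AB∈X A′B′∈X x≢y) (edge⇒adjacent 1≤k AB∈X A′B′∈X)
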